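{- Let $\mathcal C$ be a coherent category with a parametrised natural number object $(N,\mathsf 0,\mathsf s)$, $X$ an object and $\varphi(x,y)$ a complemented subobject of $X\times N$ with complement $\neg\varphi$. Then $X\models\exists y\,\varphi(x,y)\vdash\exists y\,(\varphi(x,y)\wedge\forall z<y\,\neg\varphi(x,z))$.
   Context: A coherent category has finite limits, pullback-stable image factorisations and pullback-stable finite unions of subobjects. A parametrised natural number object (PNO) is an object $N$ with $\mathsf 0:1\to N$, $\mathsf s:N\to N$ such that for all $f:A\to X$, $g:X\to X$ there is a unique $r:A\times N\to X$ with $r\circ\langle\mathrm{id},\mathsf 0\rangle=f$ and $r\circ(\mathrm{id}\times\mathsf s)=g\circ r$; it yields internally all primitive recursive operations on $N$ and the order $x<y$ (the subobject $\exists w(x+\mathsf sw=y)$). A subobject $\chi$ of $Y$ is complemented if there is $\neg\chi$ with $\chi\wedge\neg\chi=\bot$, $\chi\vee\neg\chi=\top$; its character $\mathsf c_\chi:Y\cong\chi\sqcup\neg\chi\to N$ is $0$ on $\chi$ and $\mathsf s\mathsf 0$ on $\neg\chi$. For a complemented $\chi(x,y)\le X\times N$, $\mu_\chi:X\times N\to N$ is defined by internal primitive recursion: $\mu_\chi(x,0)=0$, $\mu_\chi(x,z+1)=\mu_\chi(x,z)+\mathsf c_\chi(x,\mu_\chi(x,z))$; and the bounded universal quantifier is defined as the subobject $\forall z<y\,\chi(x,z):=\big(y=\mu_{\neg\chi}(x,y)\big)$ of $X\times N$. Notation: $Y\models\alpha\vdash\beta$ means $\alpha\le\beta$ in $\mathrm{Sub}(Y)$,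 formulas being read in the internal logic of $\mathcal C$. -}

module Defs where

open import Level using (Level; _⊔_) renaming (suc to lsuc)
open import Relation.Binary using (Rel; IsEquivalence)
open import Data.Product using (Σ; _,_; _×_)

record Category (o ℓ e : Level) : Set (lsuc (o ⊔ ℓ ⊔ e)) where
  infixr 9 _∘_
  infix  4 _≈_
  field
    Obj       : Set o
    _⇒_       : Obj → Obj → Set ℓ
    _≈_       : ∀ {A B} → Rel (A ⇒ B) e
    id        : ∀ {A} → A ⇒ A
    _∘_       : ∀ {A B C} → B ⇒ C → A ⇒ B → A ⇒ C
    equiv     : ∀ {A B} → IsEquivalence (_≈_ {A} {B})
    assoc     : ∀ {A B C D} {f : A ⇒ B} {g : B ⇒ C} {h : C ⇒ D} →
                (h ∘ g) ∘ f ≈ h ∘ (g ∘ f)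
    identityˡ : ∀ {A B} {f : A ⇒ B} → id ∘ f ≈ f
    identityʳ : ∀ {A B} {f : A ⇒ B} → f ∘ id ≈ f
    ∘-resp-≈  : ∀ {A B C} {f h : B ⇒ C} {g i : A ⇒ B} →
                f ≈ h → g ≈ i → f ∘ g ≈ h ∘ i

module _ {o ℓ e} (C : Category o ℓ e) where
  open Category C

  Mono : ∀ {A B} → A ⇒ B → Set (o ⊔ ℓ ⊔ e)
  Mono {A} f = ∀ {Z} (g h : Z ⇒ A) → f ∘ g ≈ f ∘ h → g ≈ h

  -- The preorder of Sub(Y), extended to arbitrary arrows into Y:
  -- f ≤ g iff f factors through g.  On monos this is the order of Sub(Y).
  infix 4 _≤ₛ_
  _≤ₛ_ : ∀ {A B Y} → A ⇒ Y → B ⇒ Y → Set (ℓ ⊔ e)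
  _≤ₛ_ {A} {B} f g = Σ (A ⇒ B) (λ h → f ≈ g ∘ h)

  record Terminal : Set (o ⊔ ℓ ⊔ e) where
    field
      ⊤        : Obj
      !        : ∀ {A} → A ⇒ ⊤
      !-unique : ∀ {A} (f : A ⇒ ⊤) → f ≈ !

  record Product (A B : Obj) : Set (o ⊔ ℓ ⊔ e) where
    field
      A×B     : Obj
      π₁      : A×B ⇒ A
      π₂      : A×B ⇒ B
      ⟨_,_⟩   : ∀ {Z} → Z ⇒ A → Z ⇒ B → Z ⇒ A×B
      project₁ : ∀ {Z} {f : Z ⇒ A} {g : Z ⇒ B} → π₁ ∘ ⟨ f , g ⟩ ≈ f
      project₂ : ∀ {Z} {f : Z ⇒ A} {g : Z ⇒ B} → π₂ ∘ ⟨ f , g ⟩ ≈ g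
      unique   : ∀ {Z} {f : Z ⇒ A} {g : Z ⇒ B} (h : Z ⇒ A×B) →
                 π₁ ∘ h ≈ f → π₂ ∘ h ≈ g → h ≈ ⟨ f , g ⟩

  record Pullback {A B Y : Obj} (f : A ⇒ Y) (g : B ⇒ Y) : Set (o ⊔ ℓ ⊔ e) where
    field
      P         : Obj
      p₁        : P ⇒ A
      p₂        : P ⇒ B
      commute   : f ∘ p₁ ≈ g ∘ p₂
      universal : ∀ {Z} (h₁ : Z ⇒ A) (h₂ : Z ⇒ B) → f ∘ h₁ ≈ g ∘ h₂ → Z ⇒ P
      p₁∘universal : ∀ {Z} {h₁ : Z ⇒ A} {h₂ : Z ⇒ B} (eq : f ∘ h₁ ≈ g ∘ h₂) →
                     p₁ ∘ universal h₁ h₂ eq ≈ h₁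
      p₂∘universal : ∀ {Z} {h₁ : Z ⇒ A} {h₂ : Z ⇒ B} (eq : f ∘ h₁ ≈ g ∘ h₂) →
                     p₂ ∘ universal h₁ h₂ eq ≈ h₂
      unique    : ∀ {Z} {h₁ : Z ⇒ A} {h₂ : Z ⇒ B} (eq : f ∘ h₁ ≈ g ∘ h₂)
                  (u : Z ⇒ P) → p₁ ∘ u ≈ h₁ → p₂ ∘ u ≈ h₂ →
                  u ≈ universal h₁ h₂ eq

  record Equalizer {A B : Obj} (f g : A ⇒ B) : Set (o ⊔ ℓ ⊔ e) where
    field
      E         : Obj
      arr       : E ⇒ A
      equality  : f ∘ arr ≈ g ∘ arr
      universal : ∀ {Z} (h : Z ⇒ A) → f ∘ h ≈ g ∘ h → Z ⇒ E
      factors   : ∀ {Z} {h : Z ⇒ A} (eq : f ∘ h ≈ g ∘ h) →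
                  arr ∘ universal h eq ≈ h
      unique    : ∀ {Z} {h : Z ⇒ A} (eq : f ∘ h ≈ g ∘ h) (u : Z ⇒ E) →
                  arr ∘ u ≈ h → u ≈ universal h eq

  record Image {A Y : Obj} (f : A ⇒ Y) : Set (o ⊔ ℓ ⊔ e) where
    field
      Im       : Obj
      im       : Im ⇒ Y
      im-mono  : Mono im
      factor   : f ≤ₛ im
      least    : ∀ {M} (m : M ⇒ Y) → Mono m → f ≤ₛ m → im ≤ₛ m

  record Union {A B Y : Obj} (f : A ⇒ Y) (g : B ⇒ Y) : Set (o ⊔ ℓ ⊔ e) where
    field
      U        : Obj
      ∪        : U ⇒ Y
      ∪-mono   : Mono ∪
      inl      : f ≤ₛ ∪
      inr      : g ≤ₛ ∪
      least    : ∀ {M} (m : M ⇒ Y) → Mono m → f ≤ₛ m → g ≤ₛ m → ∪ ≤ₛ m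

  record Bottom (Y : Obj) : Set (o ⊔ ℓ ⊔ e) where
    field
      B        : Obj
      ⊥        : B ⇒ Y
      ⊥-mono   : Mono ⊥
      least    : ∀ {M} (m : M ⇒ Y) → Mono m → ⊥ ≤ₛ m

record Coherent {o ℓ e} (C : Category o ℓ e) : Set (o ⊔ ℓ ⊔ e) where
  open Category C
  field
    terminal  : Terminal C
    product   : ∀ A B → Product C A B
    pullback  : ∀ {A B Y} (f : A ⇒ Y) (g : B ⇒ Y) → Pullback C f g
    equalizer : ∀ {A B} (f g : A ⇒ B) → Equalizer C f g
    image     : ∀ {A Y} (f : A ⇒ Y) → Image C f
    union     : ∀ {A B Y} (f : A ⇒ Y) (g : B ⇒ Y) → Union C f g
    bottom    : ∀ Y → Bottom C Y

  _^*_ : ∀ {A Y Z} (g : Z ⇒ Y) (f : A ⇒ Y) → Pullback.P (pullback f g) ⇒ Z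
  _^*_ g f = Pullback.p₂ (pullback f g)

  field
    -- pullback-stability (the reverse inclusions hold automatically)
    image-stable  : ∀ {A Y Z} (f : A ⇒ Y) (g : Z ⇒ Y) →
                    _≤ₛ_ C (g ^* Image.im (image f)) (Image.im (image (g ^* f)))
    union-stable  : ∀ {A B Y Z} (f₁ : A ⇒ Y) (f₂ : B ⇒ Y) (g : Z ⇒ Y) →
                    _≤ₛ_ C (g ^* Union.∪ (union f₁ f₂))
                           (Union.∪ (union (g ^* f₁) (g ^* f₂)))
    bottom-stable : ∀ {Y Z} (g : Z ⇒ Y) →
                    _≤ₛ_ C (g ^* Bottom.⊥ (bottom Y)) (Bottom.⊥ (bottom Z))

module _ {o ℓ e} {C : Category o ℓ e} (K : Coherent C) where
  open Category C
  open Coherent K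

  infixr 2 _×₀_
  _×₀_ : Obj → Obj → Obj
  A ×₀ B = Product.A×B (product A B)

  π₁ : ∀ {A B} → (A ×₀ B) ⇒ A
  π₁ {A} {B} = Product.π₁ (product A B)

  π₂ : ∀ {A B} → (A ×₀ B) ⇒ B
  π₂ {A} {B} = Product.π₂ (product A B)

  ⟨_,_⟩ : ∀ {Z A B} → Z ⇒ A → Z ⇒ B → Z ⇒ (A ×₀ B)
  ⟨_,_⟩ {Z} {A} {B} f g = Product.⟨_,_⟩ (product A B) f g

  𝟙 : Obj
  𝟙 = Terminal.⊤ terminal

  ! : ∀ {A} → A ⇒ 𝟙
  ! = Terminal.! terminal

  record PNO : Set (o ⊔ ℓ ⊔ e) where
    field
      N    : Obj
      zero : 𝟙 ⇒ N
      suc  : N ⇒ N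
      rec  : ∀ {A X} → A ⇒ X → X ⇒ X → (A ×₀ N) ⇒ X
      rec-zero   : ∀ {A X} {f : A ⇒ X} {g : X ⇒ X} →
                   rec f g ∘ ⟨ id , zero ∘ ! ⟩ ≈ f
      rec-suc    : ∀ {A X} {f : A ⇒ X} {g : X ⇒ X} →
                   rec f g ∘ ⟨ π₁ , suc ∘ π₂ ⟩ ≈ g ∘ rec f g
      rec-unique : ∀ {A X} {f : A ⇒ X} {g : X ⇒ X} (r : (A ×₀ N) ⇒ X) →
                   r ∘ ⟨ id , zero ∘ ! ⟩ ≈ f →
                   r ∘ ⟨ π₁ , suc ∘ π₂ ⟩ ≈ g ∘ r → r ≈ rec f g

  record Complemented {Y A B : Obj} (φ : A ⇒ Y) (¬φ : B ⇒ Y) : Set (o ⊔ ℓ ⊔ e) where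
    field
      φ-mono  : Mono C φ
      ¬φ-mono : Mono C ¬φ
      -- φ ∧ ¬φ = ⊥  (meet = pullback; ⊥ ≤ anything is automatic)
      disjoint : _≤ₛ_ C (φ ∘ Pullback.p₁ (pullback φ ¬φ)) (Bottom.⊥ (bottom Y))
      -- φ ∨ ¬φ = ⊤  (⊤ = id; the converse inclusion is automatic)
      covering : _≤ₛ_ C (id {Y}) (Union.∪ (union φ ¬φ))

  module Internal (P : PNO) where
    open PNO P

    add : (N ×₀ N) ⇒ N
    add = rec id suc

    -- "c is the character of the complemented subobject χ (complement ¬χ)":
    -- 0 on χ and s0 on ¬χ (such c exists and is unique since Y ≅ χ ⊔ ¬χ)
    IsCharacter : ∀ {Y A B} → A ⇒ Y → B ⇒ Y → Y ⇒ N → Set e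
    IsCharacter χ ¬χ c = (c ∘ χ ≈ zero ∘ !) × (c ∘ ¬χ ≈ (suc ∘ zero) ∘ !)

    -- μ_χ : X×N → N by internal primitive recursion, from a character
    -- c : X×N → N of χ:  μ(x,0)=0,  μ(x,z+1) = μ(x,z) + c(x, μ(x,z)).
    -- Implemented by recursion into X×N carrying the parameter x.
    μ : ∀ {X} → (X ×₀ N) ⇒ N → (X ×₀ N) ⇒ N
    μ {X} c = π₂ ∘ rec {X} {X ×₀ N} ⟨ id , zero ∘ ! ⟩ ⟨ π₁ , add ∘ ⟨ π₂ , c ⟩ ⟩

    eqμ : ∀ {X} (c : (X ×₀ N) ⇒ N) →
          Equalizer.E (equalizer (π₂ {X} {N}) (μ c)) ⇒ (X ×₀ N)
    eqμ {X} c = Equalizer.arr (equalizer (π₂ {X} {N}) (μ c))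

    _∧ₛ_ : ∀ {A B Y} (f : A ⇒ Y) (g : B ⇒ Y) → Pullback.P (pullback f g) ⇒ Y
    f ∧ₛ g = f ∘ Pullback.p₁ (pullback f g)

    ∃y : ∀ {X A} (f : A ⇒ (X ×₀ N)) → Image.Im (image (π₁ {X} {N} ∘ f)) ⇒ X
    ∃y {X} f = Image.im (image (π₁ {X} {N} ∘ f))

{-# OPTIONS --safe #-}
-- Let search : X × N → X × N be (x , z) ↦ (x , μ c (x , z)): starting from z = 0 it
-- advances while ¬φ holds and stays put once it reaches a point of φ.  By induction
-- on z every point is either fixed by search or sent into φ, so search maps φ into
-- φ; a second induction shows that search is idempotent.  Hence for (x , y) in φ
-- the point search (x , y) = (x , y′) lies in φ and satisfies y′ = μ c (x , y′),
-- a witness over the same x.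
module Submission where

open import Data.Product using (_,_; proj₁; proj₂)
open import Relation.Binary using (IsEquivalence)
open import Relation.Binary.Bundles using (Setoid)
import Relation.Binary.Reasoning.Setoid as SetoidReasoning
open import Defs hiding (π₁; π₂; ⟨_,_⟩; !)

module CategoryFacts {o ℓ e} (C : Category o ℓ e) where
  open Category C

  hom-setoid : Obj → Obj → Setoid ℓ e
  hom-setoid A B = record { isEquivalence = equiv {A} {B} }

  module HomReasoning {A B : Obj} = SetoidReasoning (hom-setoid A B)
  open module Hom {A B : Obj} = IsEquivalence (equiv {A} {B}) public
    using (refl; sym; trans)

  infixr 4 refl⟩∘⟨_
  infixl 5 _⟩∘⟨refl

  refl⟩∘⟨_ : ∀ {A B D} {f : B ⇒ D} {g i : A ⇒ B} → g ≈ i → f ∘ g ≈ f ∘ i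
  refl⟩∘⟨ p = ∘-resp-≈ refl p

  _⟩∘⟨refl : ∀ {A B D} {f h : B ⇒ D} {g : A ⇒ B} → f ≈ h → f ∘ g ≈ h ∘ g
  p ⟩∘⟨refl = ∘-resp-≈ p refl

  sym-assoc : ∀ {A B D E} {f : A ⇒ B} {g : B ⇒ D} {h : D ⇒ E} →
              h ∘ (g ∘ f) ≈ (h ∘ g) ∘ f
  sym-assoc = sym assoc

  pullˡ : ∀ {A B D E} {f : A ⇒ B} {g : B ⇒ D} {h : D ⇒ E} {i : B ⇒ E} →
          h ∘ g ≈ i → h ∘ (g ∘ f) ≈ i ∘ f
  pullˡ p = trans sym-assoc (p ⟩∘⟨refl)

  pullʳ : ∀ {A B D E} {f : A ⇒ B} {g : B ⇒ D} {h : D ⇒ E} {i : A ⇒ D} →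
          g ∘ f ≈ i → (h ∘ g) ∘ f ≈ h ∘ i
  pullʳ p = trans assoc (refl⟩∘⟨ p)

  ≤ₛ-trans : ∀ {A B D Y} {f : A ⇒ Y} {g : B ⇒ Y} {h : D ⇒ Y} →
             _≤ₛ_ C f g → _≤ₛ_ C g h → _≤ₛ_ C f h
  ≤ₛ-trans (a , f≈ga) (b , g≈hb) = b ∘ a , trans f≈ga (trans (g≈hb ⟩∘⟨refl) assoc)

  ≤ₛ-respˡ-≈ : ∀ {A B Y} {f f′ : A ⇒ Y} {g : B ⇒ Y} →
               f ≈ f′ → _≤ₛ_ C f g → _≤ₛ_ C f′ g
  ≤ₛ-respˡ-≈ f≈f′ (a , f≈ga) = a , trans (sym f≈f′) f≈ga

  ∘-monoʳ-≤ₛ : ∀ {A B Y W} {f : A ⇒ Y} {g : B ⇒ Y} (k : Y ⇒ W) →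
               _≤ₛ_ C f g → _≤ₛ_ C (k ∘ f) (k ∘ g)
  ∘-monoʳ-≤ₛ k (a , f≈ga) = a , trans (refl⟩∘⟨ f≈ga) sym-assoc

  Image-monotone : ∀ {A B Y} {f : A ⇒ Y} {g : B ⇒ Y} (I : Image C f) (J : Image C g) →
                   _≤ₛ_ C f g → _≤ₛ_ C (Image.im I) (Image.im J)
  Image-monotone I J f≤g =
    Image.least I (Image.im J) (Image.im-mono J) (≤ₛ-trans f≤g (Image.factor J))

  module _ {A B : Obj} {f g : A ⇒ B} (E : Equalizer C f g) where
    open Equalizer E

    arr-mono : Mono C arr
    arr-mono a b arr∘a≈arr∘b = trans (unique eq a arr∘a≈arr∘b) (sym (unique eq b refl))
      where
        eq : f ∘ (arr ∘ b) ≈ g ∘ (arr ∘ b)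
        eq = trans (pullˡ equality) assoc

    ≤ₛ-arr : ∀ {Z} (x : Z ⇒ A) → f ∘ x ≈ g ∘ x → _≤ₛ_ C x arr
    ≤ₛ-arr x eq = universal x eq , sym (factors eq)

    equalizer-total⇒≈ : _≤ₛ_ C id arr → f ≈ g
    equalizer-total⇒≈ (h , id≈arr∘h) = begin
      f               ≈⟨ identityʳ ⟨
      f ∘ id          ≈⟨ refl⟩∘⟨ id≈arr∘h ⟩
      f ∘ (arr ∘ h)   ≈⟨ pullˡ equality ⟩
      (g ∘ arr) ∘ h   ≈⟨ pullʳ (sym id≈arr∘h) ⟩
      g ∘ id          ≈⟨ identityʳ ⟩
      g               ∎
      where open HomReasoning

  module _ {A B Y : Obj} {m : A ⇒ Y} {k : B ⇒ Y} (Q : Pullback C m k) where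
    open Pullback Q

    p₂-mono : Mono C m → Mono C p₂
    p₂-mono m-mono a b p₂∘a≈p₂∘b =
      trans (unique eq a p₁∘a≈p₁∘b p₂∘a≈p₂∘b) (sym (unique eq b refl refl))
      where
        p₁∘a≈p₁∘b : p₁ ∘ a ≈ p₁ ∘ b
        p₁∘a≈p₁∘b = m-mono _ _ (begin
          m ∘ (p₁ ∘ a)   ≈⟨ pullˡ commute ⟩
          (k ∘ p₂) ∘ a   ≈⟨ pullʳ p₂∘a≈p₂∘b ⟩
          k ∘ (p₂ ∘ b)   ≈⟨ pullˡ (sym commute) ⟩
          (m ∘ p₁) ∘ b   ≈⟨ assoc ⟩
          m ∘ (p₁ ∘ b)   ∎)
          where open HomReasoning
        eq : m ∘ (p₁ ∘ b) ≈ k ∘ (p₂ ∘ b)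
        eq = trans (pullˡ commute) assoc

    ≤ₛ-pullback⁺ : ∀ {Z} {f : Z ⇒ B} → _≤ₛ_ C (k ∘ f) m → _≤ₛ_ C f p₂
    ≤ₛ-pullback⁺ (t , k∘f≈m∘t) = universal t _ (sym k∘f≈m∘t) , sym (p₂∘universal _)

    ≤ₛ-pullback⁻ : ∀ {Z} {f : Z ⇒ B} → _≤ₛ_ C f p₂ → _≤ₛ_ C (k ∘ f) m
    ≤ₛ-pullback⁻ (t , f≈p₂∘t) =
      p₁ ∘ t , trans (refl⟩∘⟨ f≈p₂∘t) (trans (pullˡ (sym commute)) assoc)

    ≤ₛ-meet : ∀ {Z} {f : Z ⇒ Y} → _≤ₛ_ C f m → _≤ₛ_ C f k → _≤ₛ_ C f (m ∘ p₁)
    ≤ₛ-meet (a , f≈m∘a) (b , f≈k∘b) =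
      universal a b (trans (sym f≈m∘a) f≈k∘b) , trans f≈m∘a (sym (pullʳ (p₁∘universal _)))

module CoherentFacts {o ℓ e} {C : Category o ℓ e} (K : Coherent C) where
  open Category C
  open Coherent K
  open CategoryFacts C

  infix 4 _≤_
  _≤_ : ∀ {A B Y} → A ⇒ Y → B ⇒ Y → Set _
  _≤_ = _≤ₛ_ C

  infixr 25 _×_
  _×_ : Obj → Obj → Obj
  _×_ = _×₀_ K

  infixr 6 _∪ₛ_
  _∪ₛ_ : ∀ {A B Y} (f : A ⇒ Y) (g : B ⇒ Y) → Union.U (union f g) ⇒ Y
  f ∪ₛ g = Union.∪ (union f g)

  π₁ : ∀ {A B} → (A × B) ⇒ A
  π₁ = Defs.π₁ K

  π₂ : ∀ {A B} → (A × B) ⇒ B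
  π₂ = Defs.π₂ K

  ⟨_,_⟩ : ∀ {Z A B} → Z ⇒ A → Z ⇒ B → Z ⇒ (A × B)
  ⟨_,_⟩ = Defs.⟨_,_⟩ K

  ! : ∀ {A} → A ⇒ 𝟙 K
  ! = Defs.! K

  module _ {A B : Obj} where
    open Product (product A B) public using (project₁; project₂)

    ⟨⟩-unique : ∀ {Z} {f : Z ⇒ A} {g : Z ⇒ B} (h : Z ⇒ A × B) →
                π₁ ∘ h ≈ f → π₂ ∘ h ≈ g → h ≈ ⟨ f , g ⟩
    ⟨⟩-unique = Product.unique (product A B)

    ⟨⟩∘ : ∀ {W Z} {f : Z ⇒ A} {g : Z ⇒ B} {h : W ⇒ Z} →
          ⟨ f , g ⟩ ∘ h ≈ ⟨ f ∘ h , g ∘ h ⟩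
    ⟨⟩∘ = ⟨⟩-unique _ (pullˡ project₁) (pullˡ project₂)

    ⟨⟩-cong₂ : ∀ {Z} {f f′ : Z ⇒ A} {g g′ : Z ⇒ B} →
               f ≈ f′ → g ≈ g′ → ⟨ f , g ⟩ ≈ ⟨ f′ , g′ ⟩
    ⟨⟩-cong₂ f≈f′ g≈g′ = ⟨⟩-unique _ (trans project₁ f≈f′) (trans project₂ g≈g′)

    ⟨⟩-η : ∀ {Z} {h : Z ⇒ A × B} → ⟨ π₁ ∘ h , π₂ ∘ h ⟩ ≈ h
    ⟨⟩-η {h = h} = sym (⟨⟩-unique h refl refl)

  !∘ : ∀ {A B} {h : A ⇒ B} → ! ∘ h ≈ !
  !∘ = Terminal.!-unique terminal _

  ∘-∪ₛ-least : ∀ {A₁ A₂ Y W M} {f₁ : A₁ ⇒ Y} {f₂ : A₂ ⇒ Y} {k : Y ⇒ W} {m : M ⇒ W} →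
               Mono C m → (k ∘ f₁) ≤ m → (k ∘ f₂) ≤ m → (k ∘ (f₁ ∪ₛ f₂)) ≤ m
  ∘-∪ₛ-least {f₁ = f₁} {f₂} {k} {m} m-mono k∘f₁≤m k∘f₂≤m =
    ≤ₛ-pullback⁻ Q (Union.least (union f₁ f₂) _ (p₂-mono Q m-mono)
      (≤ₛ-pullback⁺ Q k∘f₁≤m) (≤ₛ-pullback⁺ Q k∘f₂≤m))
    where Q = pullback m k

  covers-stable : ∀ {A₁ A₂ Y Z} {f₁ : A₁ ⇒ Y} {f₂ : A₂ ⇒ Y} (g : Z ⇒ Y) →
                  id ≤ (f₁ ∪ₛ f₂) → id ≤ ((g ^* f₁) ∪ₛ (g ^* f₂))
  covers-stable {f₁ = f₁} {f₂} g (h , id≈∪∘h) =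
    ≤ₛ-trans (≤ₛ-pullback⁺ (pullback (f₁ ∪ₛ f₂) g) g∘id≤∪) (union-stable f₁ f₂ g)
    where
      g∘id≤∪ : (g ∘ id) ≤ (f₁ ∪ₛ f₂)
      g∘id≤∪ = h ∘ g , trans identityʳ (trans (sym identityˡ) (trans (id≈∪∘h ⟩∘⟨refl) assoc))

  ≤-by-cases : ∀ {A₁ A₂ Y Z W M} {f₁ : A₁ ⇒ Y} {f₂ : A₂ ⇒ Y} {k : Z ⇒ W} {m : M ⇒ W} →
               id ≤ (f₁ ∪ₛ f₂) → (g : Z ⇒ Y) → Mono C m →
               (∀ {V} (j : V ⇒ Z) (a : V ⇒ A₁) → g ∘ j ≈ f₁ ∘ a → (k ∘ j) ≤ m) →
               (∀ {V} (j : V ⇒ Z) (b : V ⇒ A₂) → g ∘ j ≈ f₂ ∘ b → (k ∘ j) ≤ m) →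
               k ≤ m
  ≤-by-cases {f₁ = f₁} {f₂} {k} {m} cover g m-mono case₁ case₂ =
    ≤ₛ-respˡ-≈ identityʳ (≤ₛ-pullback⁻ Q (≤ₛ-trans (covers-stable g cover)
      (Union.least (union (g ^* f₁) (g ^* f₂)) _ (p₂-mono Q m-mono)
        (≤ₛ-pullback⁺ Q (case₁ _ _ (sym (Pullback.commute (pullback f₁ g)))))
        (≤ₛ-pullback⁺ Q (case₂ _ _ (sym (Pullback.commute (pullback f₂ g))))))))
    where Q = pullback m k

module NaturalNumbers {o ℓ e} {C : Category o ℓ e} (K : Coherent C) (P : PNO K) where
  open Category C
  open Coherent K
  open CategoryFacts C
  open CoherentFacts K
  open PNO P
  open Internal K P

  zeroₚ : ∀ {A} → A ⇒ A × N
  zeroₚ = ⟨ id , zero ∘ ! ⟩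

  sucₚ : ∀ {A} → A × N ⇒ A × N
  sucₚ = ⟨ π₁ , suc ∘ π₂ ⟩

  sucₚ∘⟨⟩ : ∀ {Z A} {u : Z ⇒ A} {v : Z ⇒ N} → sucₚ ∘ ⟨ u , v ⟩ ≈ ⟨ u , suc ∘ v ⟩
  sucₚ∘⟨⟩ = trans ⟨⟩∘ (⟨⟩-cong₂ project₁ (pullʳ project₂))

  -- The witness is rec z s: both m ∘ rec z s and id solve the recursion
  -- defining rec zeroₚ sucₚ.
  induction : ∀ {A S} (m : S ⇒ A × N) → zeroₚ ≤ m → (sucₚ ∘ m) ≤ m → id ≤ m
  induction m (z , zeroₚ≈m∘z) (s , sucₚ∘m≈m∘s) =
    rec z s , sym (trans m∘rec≈rec (sym id≈rec))
    where
      m∘rec≈rec : m ∘ rec z s ≈ rec zeroₚ sucₚ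
      m∘rec≈rec = rec-unique _ (trans (pullʳ rec-zero) (sym zeroₚ≈m∘z))
        (trans (pullʳ rec-suc) (trans (pullˡ (sym sucₚ∘m≈m∘s)) assoc))
      id≈rec : id ≈ rec zeroₚ sucₚ
      id≈rec = rec-unique id identityˡ (trans identityˡ (sym identityʳ))

  π₁∘rec : ∀ {A} {T : A × N ⇒ A × N} → π₁ ∘ T ≈ π₁ → π₁ ∘ rec zeroₚ T ≈ π₁
  π₁∘rec {T = T} π₁∘T≈π₁ = trans π₁∘rec≈rec (sym π₁≈rec)
    where
      π₁∘rec≈rec : π₁ ∘ rec zeroₚ T ≈ rec id id
      π₁∘rec≈rec = rec-unique _ (trans (pullʳ rec-zero) project₁)
        (trans (pullʳ rec-suc) (trans (pullˡ π₁∘T≈π₁) (sym identityˡ)))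
      π₁≈rec : π₁ ≈ rec id id
      π₁≈rec = rec-unique π₁ project₁ (trans project₁ (sym identityˡ))

  add-zeroʳ : ∀ {Z} (v : Z ⇒ N) → add ∘ ⟨ v , zero ∘ ! ⟩ ≈ v
  add-zeroʳ v = begin
    add ∘ ⟨ v , zero ∘ ! ⟩              ≈⟨ refl⟩∘⟨ zeroₚ∘v ⟨
    add ∘ (zeroₚ ∘ v)                   ≈⟨ pullˡ rec-zero ⟩
    id ∘ v                              ≈⟨ identityˡ ⟩
    v                                   ∎
    where
      open HomReasoning
      zeroₚ∘v : zeroₚ ∘ v ≈ ⟨ v , zero ∘ ! ⟩
      zeroₚ∘v = trans ⟨⟩∘ (⟨⟩-cong₂ identityˡ (pullʳ !∘))

  add-oneʳ : ∀ {Z} (v : Z ⇒ N) → add ∘ ⟨ v , (suc ∘ zero) ∘ ! ⟩ ≈ suc ∘ v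
  add-oneʳ v = begin
    add ∘ ⟨ v , (suc ∘ zero) ∘ ! ⟩      ≈⟨ refl⟩∘⟨ ⟨⟩-cong₂ refl assoc ⟩
    add ∘ ⟨ v , suc ∘ (zero ∘ !) ⟩      ≈⟨ refl⟩∘⟨ sucₚ∘⟨⟩ ⟨
    add ∘ (sucₚ ∘ ⟨ v , zero ∘ ! ⟩)     ≈⟨ pullˡ rec-suc ⟩
    (suc ∘ add) ∘ ⟨ v , zero ∘ ! ⟩      ≈⟨ pullʳ (add-zeroʳ v) ⟩
    suc ∘ v                             ∎
    where open HomReasoning

  module Search (X : Obj) {A B : Obj} (φ : A ⇒ X × N) (¬φ : B ⇒ X × N)
                (φ-complemented : Complemented K φ ¬φ)
                (c : X × N ⇒ N) (c-character : IsCharacter φ ¬φ c) where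
    open Complemented φ-complemented

    step : X × N ⇒ X × N
    step = ⟨ π₁ , add ∘ ⟨ π₂ , c ⟩ ⟩

    -- search (x , z) = (x , μ c (x , z)): μ c is π₂ ∘ search by definition.
    search : X × N ⇒ X × N
    search = rec zeroₚ step

    step∘ : ∀ {Z} (y : Z ⇒ X × N) → step ∘ y ≈ ⟨ π₁ ∘ y , add ∘ ⟨ π₂ ∘ y , c ∘ y ⟩ ⟩
    step∘ y = trans ⟨⟩∘ (⟨⟩-cong₂ refl (pullʳ ⟨⟩∘))

    step-φ : ∀ {Z} {y : Z ⇒ X × N} {a : Z ⇒ A} → y ≈ φ ∘ a → step ∘ y ≈ y
    step-φ {y = y} y≈φ∘a = begin
      step ∘ y                                 ≈⟨ step∘ y ⟩
      ⟨ π₁ ∘ y , add ∘ ⟨ π₂ ∘ y , c ∘ y ⟩ ⟩     ≈⟨ ⟨⟩-cong₂ refl (refl⟩∘⟨ ⟨⟩-cong₂ refl c∘y) ⟩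
      ⟨ π₁ ∘ y , add ∘ ⟨ π₂ ∘ y , zero ∘ ! ⟩ ⟩  ≈⟨ ⟨⟩-cong₂ refl (add-zeroʳ _) ⟩
      ⟨ π₁ ∘ y , π₂ ∘ y ⟩                      ≈⟨ ⟨⟩-η ⟩
      y                                        ∎
      where
        open HomReasoning
        c∘y : c ∘ y ≈ zero ∘ !
        c∘y = trans (refl⟩∘⟨ y≈φ∘a) (trans (pullˡ (proj₁ c-character)) (pullʳ !∘))

    step-¬φ : ∀ {Z} {y : Z ⇒ X × N} {b : Z ⇒ B} → y ≈ ¬φ ∘ b → step ∘ y ≈ sucₚ ∘ y
    step-¬φ {y = y} y≈¬φ∘b = begin
      step ∘ y                                          ≈⟨ step∘ y ⟩
      ⟨ π₁ ∘ y , add ∘ ⟨ π₂ ∘ y , c ∘ y ⟩ ⟩              ≈⟨ ⟨⟩-cong₂ refl (refl⟩∘⟨ ⟨⟩-cong₂ refl c∘y) ⟩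
      ⟨ π₁ ∘ y , add ∘ ⟨ π₂ ∘ y , (suc ∘ zero) ∘ ! ⟩ ⟩  ≈⟨ ⟨⟩-cong₂ refl (add-oneʳ _) ⟩
      ⟨ π₁ ∘ y , suc ∘ (π₂ ∘ y) ⟩                       ≈⟨ sucₚ∘⟨⟩ ⟨
      sucₚ ∘ ⟨ π₁ ∘ y , π₂ ∘ y ⟩                        ≈⟨ refl⟩∘⟨ ⟨⟩-η ⟩
      sucₚ ∘ y                                          ∎
      where
        open HomReasoning
        c∘y : c ∘ y ≈ (suc ∘ zero) ∘ !
        c∘y = trans (refl⟩∘⟨ y≈¬φ∘b) (trans (pullˡ (proj₂ c-character)) (pullʳ !∘))

    search-suc : ∀ {Z} {x : Z ⇒ X × N} → search ∘ (sucₚ ∘ x) ≈ step ∘ (search ∘ x)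
    search-suc = trans (pullˡ rec-suc) assoc

    search-suc-φ : ∀ {Z} {x : Z ⇒ X × N} {a : Z ⇒ A} →
                   search ∘ x ≈ φ ∘ a → search ∘ (sucₚ ∘ x) ≈ φ ∘ a
    search-suc-φ search∘x≈φ∘a =
      trans search-suc (trans (refl⟩∘⟨ search∘x≈φ∘a) (step-φ refl))

    search-suc-¬φ : ∀ {Z} {x : Z ⇒ X × N} {b : Z ⇒ B} →
                    search ∘ x ≈ ¬φ ∘ b → search ∘ (sucₚ ∘ x) ≈ sucₚ ∘ (search ∘ x)
    search-suc-¬φ search∘x≈¬φ∘b = trans search-suc (step-¬φ search∘x≈¬φ∘b)

    module Fixed = Equalizer (equalizer search id)

    found : Pullback.P (pullback φ search) ⇒ X × N
    found = search ^* φ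

    fixed : ∀ {Z} (j : Z ⇒ Fixed.E) → search ∘ (Fixed.arr ∘ j) ≈ Fixed.arr ∘ j
    fixed j = trans (pullˡ Fixed.equality) (identityˡ ⟩∘⟨refl)

    ≤-fixed : ∀ {Z} {x : Z ⇒ X × N} → search ∘ x ≈ x → x ≤ Fixed.arr
    ≤-fixed search∘x≈x = ≤ₛ-arr (equalizer search id) _ (trans search∘x≈x (sym identityˡ))

    ≤-found : ∀ {Z} {x : Z ⇒ X × N} {a : Z ⇒ A} → search ∘ x ≈ φ ∘ a → x ≤ found
    ≤-found search∘x≈φ∘a = ≤ₛ-pullback⁺ (pullback φ search) (_ , search∘x≈φ∘a)

    found-φ : search ∘ found ≈ φ ∘ Pullback.p₁ (pullback φ search)
    found-φ = sym (Pullback.commute (pullback φ search))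

    fixed-or-found : id ≤ (Fixed.arr ∪ₛ found)
    fixed-or-found = induction _ (≤ₛ-trans (≤-fixed rec-zero) inl)
      (∘-∪ₛ-least ∪-mono (≤-by-cases covering Fixed.arr ∪-mono fixed-φ fixed-¬φ)
                         (≤ₛ-trans (≤-found (search-suc-φ found-φ)) inr))
      where
        open Union (union Fixed.arr found) using (∪-mono; inl; inr)
        fixed-φ : ∀ {V} (j : V ⇒ Fixed.E) (a : V ⇒ A) → Fixed.arr ∘ j ≈ φ ∘ a →
                  ((sucₚ ∘ Fixed.arr) ∘ j) ≤ (Fixed.arr ∪ₛ found)
        fixed-φ j a arr∘j≈φ∘a = ≤ₛ-trans
          (≤-found (trans (refl⟩∘⟨ assoc) (search-suc-φ (trans (fixed j) arr∘j≈φ∘a)))) inr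
        fixed-¬φ : ∀ {V} (j : V ⇒ Fixed.E) (b : V ⇒ B) → Fixed.arr ∘ j ≈ ¬φ ∘ b →
                   ((sucₚ ∘ Fixed.arr) ∘ j) ≤ (Fixed.arr ∪ₛ found)
        fixed-¬φ j b arr∘j≈¬φ∘b = ≤ₛ-trans (≤-fixed (begin
          search ∘ ((sucₚ ∘ Fixed.arr) ∘ j)  ≈⟨ refl⟩∘⟨ assoc ⟩
          search ∘ (sucₚ ∘ (Fixed.arr ∘ j))  ≈⟨ search-suc-¬φ (trans (fixed j) arr∘j≈¬φ∘b) ⟩
          sucₚ ∘ (search ∘ (Fixed.arr ∘ j))  ≈⟨ refl⟩∘⟨ fixed j ⟩
          sucₚ ∘ (Fixed.arr ∘ j)             ≈⟨ assoc ⟨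
          (sucₚ ∘ Fixed.arr) ∘ j             ∎)) inl
          where open HomReasoning

    search-φ : (search ∘ φ) ≤ φ
    search-φ = ≤-by-cases fixed-or-found φ φ-mono φ-fixed φ-found
      where
        φ-fixed : ∀ {V} (j : V ⇒ A) (a : V ⇒ Fixed.E) → φ ∘ j ≈ Fixed.arr ∘ a →
                  ((search ∘ φ) ∘ j) ≤ φ
        φ-fixed j a φ∘j≈arr∘a = j , (begin
          (search ∘ φ) ∘ j        ≈⟨ pullʳ φ∘j≈arr∘a ⟩
          search ∘ (Fixed.arr ∘ a) ≈⟨ fixed a ⟩
          Fixed.arr ∘ a           ≈⟨ φ∘j≈arr∘a ⟨
          φ ∘ j                   ∎)
          where open HomReasoning
        φ-found : ∀ {V} (j : V ⇒ A) (b : V ⇒ Pullback.P (pullback φ search)) →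
                  φ ∘ j ≈ found ∘ b → ((search ∘ φ) ∘ j) ≤ φ
        φ-found j b φ∘j≈found∘b =
          _ , trans (pullʳ φ∘j≈found∘b) (trans (pullˡ found-φ) assoc)

    search-idempotent : search ∘ search ≈ search
    search-idempotent = equalizer-total⇒≈ E
      (induction E.arr (≤ₛ-arr E zeroₚ (pullʳ rec-zero))
        (≤-by-cases covering (search ∘ E.arr) (arr-mono E) case-φ case-¬φ))
      where
        E = equalizer (search ∘ search) search
        module E = Equalizer E
        open HomReasoning

        settled : ∀ {V} (j : V ⇒ E.E) → search ∘ (search ∘ (E.arr ∘ j)) ≈ search ∘ (E.arr ∘ j)
        settled j = begin
          search ∘ (search ∘ (E.arr ∘ j))  ≈⟨ sym-assoc ⟩
          (search ∘ search) ∘ (E.arr ∘ j)  ≈⟨ pullˡ E.equality ⟩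
          (search ∘ E.arr) ∘ j             ≈⟨ assoc ⟩
          search ∘ (E.arr ∘ j)             ∎

        ≤-E : ∀ {V} (j : V ⇒ E.E) →
              search ∘ (step ∘ (search ∘ (E.arr ∘ j))) ≈ step ∘ (search ∘ (E.arr ∘ j)) →
              ((sucₚ ∘ E.arr) ∘ j) ≤ E.arr
        ≤-E j step-settled = ≤ₛ-arr E _ (begin
          (search ∘ search) ∘ ((sucₚ ∘ E.arr) ∘ j)  ≈⟨ pullʳ search∘suc ⟩
          search ∘ (step ∘ (search ∘ (E.arr ∘ j)))  ≈⟨ step-settled ⟩
          step ∘ (search ∘ (E.arr ∘ j))             ≈⟨ search∘suc ⟨
          search ∘ ((sucₚ ∘ E.arr) ∘ j)             ∎)
          where
            search∘suc : search ∘ ((sucₚ ∘ E.arr) ∘ j) ≈ step ∘ (search ∘ (E.arr ∘ j))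
            search∘suc = trans (refl⟩∘⟨ assoc) search-suc

        case-φ : ∀ {V} (j : V ⇒ E.E) (a : V ⇒ A) → (search ∘ E.arr) ∘ j ≈ φ ∘ a →
                 ((sucₚ ∘ E.arr) ∘ j) ≤ E.arr
        case-φ j a y≈φ∘a = ≤-E j (begin
          search ∘ (step ∘ y)  ≈⟨ refl⟩∘⟨ step-y ⟩
          search ∘ y           ≈⟨ settled j ⟩
          y                    ≈⟨ step-y ⟨
          step ∘ y             ∎)
          where
            y = search ∘ (E.arr ∘ j)
            step-y : step ∘ y ≈ y
            step-y = step-φ (trans sym-assoc y≈φ∘a)

        case-¬φ : ∀ {V} (j : V ⇒ E.E) (b : V ⇒ B) → (search ∘ E.arr) ∘ j ≈ ¬φ ∘ b →
                  ((sucₚ ∘ E.arr) ∘ j) ≤ E.arr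
        case-¬φ j b y≈¬φ∘b = ≤-E j (begin
          search ∘ (step ∘ y)     ≈⟨ refl⟩∘⟨ step-¬φ (trans sym-assoc y≈¬φ∘b) ⟩
          search ∘ (sucₚ ∘ y)     ≈⟨ search-suc ⟩
          step ∘ (search ∘ y)     ≈⟨ refl⟩∘⟨ settled j ⟩
          step ∘ y                ∎)
          where y = search ∘ (E.arr ∘ j)

    search-eqμ : (search ∘ φ) ≤ eqμ c
    search-eqμ = ≤ₛ-arr (equalizer π₂ (μ c)) _ (sym (pullʳ (pullˡ search-idempotent)))

    π₁∘search : π₁ ∘ search ≈ π₁
    π₁∘search = π₁∘rec project₁

lemma2p12 : ∀ {o ℓ e} {C : Category o ℓ e} (K : Coherent C) (P : PNO K) →
    let open Category C
        open PNO P
        open Internal K P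
    in (X : Obj) {A B : Obj} (φ : A ⇒ (_×₀_ K X N)) (¬φ : B ⇒ (_×₀_ K X N)) →
       Complemented K φ ¬φ →
       (c : (_×₀_ K X N) ⇒ N) → IsCharacter φ ¬φ c →
       _≤ₛ_ C (∃y φ) (∃y (φ ∧ₛ eqμ c))
lemma2p12 {C = C} K P X φ ¬φ φ-complemented c c-character =
  Image-monotone (image _) (image _)
    (≤ₛ-respˡ-≈ (pullˡ π₁∘search)
      (∘-monoʳ-≤ₛ π₁ (≤ₛ-meet (pullback φ (eqμ c)) search-φ search-eqμ)))
  where
    open Coherent K
    open CategoryFacts C
    open CoherentFacts K using (π₁)
    open Internal K P
    open NaturalNumbers.Search K P X φ ¬φ φ-complemented c c-character
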